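{- Assume the $abc$ conjecture. Let $a, d$ be positive integers with $\gcd(a,d)=1$, and let $a_n = a + nd$ for $n \geq 0$. Then there are only finitely many $k \geq 0$ such that $a_k$, $a_{k+1}$ and $a_{k+2}$ are all powerful numbers.
   Context: A positive integer $x$ is called powerful if for every prime $p$, $p \mid x$ implies $p^2 \mid x$. For a positive integer $x$ with prime factorization $x = p_1^{a_1}\cdots p_m^{a_m}$ (distinct primes, $a_i \geq 1$), the radical is ${\rm rad}(x) = p_1 \cdots p_m$ (with ${\rm rad}(1)=1$). The $abc$ conjecture asserts: for every $\varepsilon > 0$ there are only finitely many triples $(a,b,c)$ of positive integers with $\gcd(a,b)=1$, $a+b=c$, and ${\rm rad}(abc)^{1+\varepsilon} < c$. -}

module Defs where

open import Data.Nat using (ℕ; zero; suc; _+_; _*_; _^_; _<_; _≤_)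
open import Data.Nat.Divisibility using (_∣_; _∣?_)
open import Data.Nat.Primality using (Prime; prime?)
open import Data.Nat.GCD using (gcd)
open import Data.List using (List; filter; upTo)
open import Data.Nat.ListAction using (product)
open import Data.Product using (_×_; Σ; ∃-syntax)
open import Relation.Binary.PropositionalEquality using (_≡_)
open import Relation.Nullary.Decidable using (_×-dec_)

Powerful : ℕ → Set
Powerful x = ∀ p → Prime p → p ∣ x → p ^ 2 ∣ x

-- rad x = product of the distinct primes dividing x (primes p < x+1).
-- rad 0 is never used (all arguments are positive); rad 1 = 1.
rad : ℕ → ℕ
rad x = product (filter (λ p → prime? p ×-dec (p ∣? x)) (upTo (suc x)))

-- abc triple of positive integers a + b = c, gcd(a,b)=1,
-- violating rad(abc)^(1+ε) < c with ε = e/q, i.e. rad(abc)^(q+e) < c^q.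
ABCExceptional : ℕ → ℕ → ℕ → ℕ → ℕ → Set
ABCExceptional e q a b c =
  1 ≤ a × 1 ≤ b × gcd a b ≡ 1 × a + b ≡ c × rad (a * b * c) ^ (q + e) < c ^ q

-- abc conjecture: for every rational ε = e/q > 0 there are only finitely many
-- such triples; since a, b < c, finiteness = a bound N on c.
ABC : Set
ABC = ∀ e q → 1 ≤ e → 1 ≤ q →
      ∃[ N ] (∀ a b c → ABCExceptional e q a b c → c < N)

{-# OPTIONS --safe #-}
-- Three consecutive powerful terms x, y, z of the progression satisfy
-- x z + d² = y², an abc sum with gcd(x z, d²) = 1. Since x, y, z are powerful,
-- rad(x z d² y²)² divides x y z d² < y³ d², so rad⁶ < y⁹ d⁶ ≤ (y²)⁵ as soon as
-- d⁶ ≤ y. Taking ε = 1/5 in abc bounds y², hence k, in that case; otherwise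
-- k < y < d⁶.
module Submission where

open import Defs
open import Data.Nat using (ℕ; zero; suc; _+_; _*_; _^_; _<_; _≤_; _≤?_; s≤s; z≤n; z<s; NonZero; >-nonZero)
open import Data.Nat.Properties
open import Data.Nat.Divisibility
open import Data.Nat.Primality using (Prime; prime?; ¬prime[1]; euclidsLemma; prime⇒nonZero)
open import Data.Nat.Coprimality using (Coprime; coprime-divisor; coprime⇒gcd≡1; gcd≡1⇒coprime)
import Data.Nat.Coprimality as Cop
open import Data.Nat.GCD using (gcd)
open import Data.Nat.ListAction using (product)
open import Data.Nat.ListAction.Properties using (product-++)
open import Data.Nat.Solver using (module +-*-Solver)
open import Data.List using (List; filter; upTo; _++_; [_])
open import Data.List.Properties using (upTo-∷ʳ; filter-++; filter-accept; filter-reject)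
open import Data.Product using (_×_; _,_; ∃-syntax)
open import Data.Sum using (_⊎_; inj₁; inj₂; [_,_]′; reduce)
open import Function using (_∘_)
open import Relation.Nullary using (¬_; yes; no; contradiction)
open import Relation.Nullary.Decidable using (_×-dec_)
open import Relation.Unary using (Decidable)
open import Relation.Binary.PropositionalEquality using (_≡_; refl; sym; trans; cong; subst; module ≡-Reasoning)

open +-*-Solver

prime∤1 : ∀ {p} → Prime p → ¬ p ∣ 1
prime∤1 pp p∣1 = ¬prime[1] (subst Prime (∣1⇒≡1 p∣1) pp)

prime∣m*n∧∤n⇒∣m : ∀ {p} m {n} → Prime p → ¬ p ∣ n → p ∣ m * n → p ∣ m
prime∣m*n∧∤n⇒∣m m {n} pp p∤n p∣m*n with euclidsLemma m n pp p∣m*n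
... | inj₁ p∣m = p∣m
... | inj₂ p∣n = contradiction p∣n p∤n

prime∣m*m⇒∣m : ∀ {p} m → Prime p → p ∣ m * m → p ∣ m
prime∣m*m⇒∣m m pp p∣m*m = reduce (euclidsLemma m m pp p∣m*m)

prime*prime∣m*n∧∤n⇒∣m : ∀ {p} m {n} → Prime p → ¬ p ∣ n → p * p ∣ m * n → p * p ∣ m
prime*prime∣m*n∧∤n⇒∣m {p} m {n} pp p∤n pp∣mn
  with prime∣m*n∧∤n⇒∣m m pp p∤n (∣-trans (m∣m*n p) pp∣mn)
... | divides s refl = *-monoˡ-∣ p (prime∣m*n∧∤n⇒∣m s pp p∤n p∣s*n)
  where
  instance
    p≢0 : NonZero p
    p≢0 = prime⇒nonZero pp
  p∣s*n : p ∣ s * n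
  p∣s*n = *-cancelˡ-∣ p (subst (p * p ∣_)
    (solve 3 (λ s p n → s :* p :* n := p :* (s :* n)) refl s p n) pp∣mn)

prime-square-extends-square-∣ : ∀ {p a m} → Prime p → ¬ p ∣ a →
                                p * p ∣ m → a * a ∣ m → (a * p) * (a * p) ∣ m
prime-square-extends-square-∣ {p} {a} pp p∤a pp∣m (divides q refl) =
  subst (_∣ q * (a * a)) (solve 2 (λ p a → p :* p :* (a :* a) := a :* p :* (a :* p)) refl p a)
    (*-monoˡ-∣ (a * a) pp∣q)
  where
  pp∣q : p * p ∣ q
  pp∣q = prime*prime∣m*n∧∤n⇒∣m q pp (p∤a ∘ prime∣m*m⇒∣m a pp) pp∣m

powerful⇒prime*prime∣ : ∀ {x p} → Powerful x → Prime p → p ∣ x → p * p ∣ x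
powerful⇒prime*prime∣ {x} {p} px pp p∣x = subst (_∣ x) (cong (p *_) (*-identityʳ p)) (px p pp p∣x)

module _ (n : ℕ) where

  primeDivisor? : Decidable (λ p → Prime p × p ∣ n)
  primeDivisor? p = prime? p ×-dec (p ∣? n)

  primeDivisorsBelow : ℕ → List ℕ
  primeDivisorsBelow m = filter primeDivisor? (upTo m)

  product-primeDivisorsBelow-suc : ∀ m → product (primeDivisorsBelow (suc m)) ≡
    product (primeDivisorsBelow m) * product (filter primeDivisor? [ m ])
  product-primeDivisorsBelow-suc m = begin
    product (filter primeDivisor? (upTo (suc m)))                ≡⟨ cong (product ∘ filter primeDivisor?) (sym (upTo-∷ʳ m)) ⟩
    product (filter primeDivisor? (upTo m ++ [ m ]))             ≡⟨ cong product (filter-++ primeDivisor? (upTo m) [ m ]) ⟩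
    product (primeDivisorsBelow m ++ filter primeDivisor? [ m ]) ≡⟨ product-++ (primeDivisorsBelow m) _ ⟩
    product (primeDivisorsBelow m) * product (filter primeDivisor? [ m ]) ∎
    where open ≡-Reasoning

  product-primeDivisorsBelow-step : ∀ m →
    (Prime m × m ∣ n) × product (primeDivisorsBelow (suc m)) ≡ product (primeDivisorsBelow m) * m
    ⊎ product (primeDivisorsBelow (suc m)) ≡ product (primeDivisorsBelow m)
  product-primeDivisorsBelow-step m with primeDivisor? m
  ... | yes pm = inj₁ (pm , trans (product-primeDivisorsBelow-suc m)
                               (cong (product (primeDivisorsBelow m) *_)
                                 (trans (cong product (filter-accept primeDivisor? pm)) (*-identityʳ m))))
  ... | no ¬pm = inj₂ (trans (product-primeDivisorsBelow-suc m)
                        (trans (cong (product (primeDivisorsBelow m) *_) (cong product (filter-reject primeDivisor? ¬pm)))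
                          (*-identityʳ _)))

  prime∤product-primeDivisorsBelow : ∀ {p} m → Prime p → m ≤ p → ¬ p ∣ product (primeDivisorsBelow m)
  prime∤product-primeDivisorsBelow zero pp _ = prime∤1 pp
  prime∤product-primeDivisorsBelow {p} (suc m) pp m<p p∣P with product-primeDivisorsBelow-step m
  ... | inj₂ eq = prime∤product-primeDivisorsBelow m pp (<⇒≤ m<p) (subst (p ∣_) eq p∣P)
  ... | inj₁ ((pm , _) , eq) =
    [ prime∤product-primeDivisorsBelow m pp (<⇒≤ m<p)
    , (λ p∣m → <⇒≱ m<p (∣⇒≤ {{prime⇒nonZero pm}} p∣m)) ]′
    (euclidsLemma _ m pp (subst (p ∣_) eq p∣P))

  product-primeDivisorsBelow-square-∣ : ∀ {M} → (∀ p → Prime p → p ∣ n → p * p ∣ M) →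
    ∀ m → product (primeDivisorsBelow m) * product (primeDivisorsBelow m) ∣ M
  product-primeDivisorsBelow-square-∣ {M} H zero = 1∣ M
  product-primeDivisorsBelow-square-∣ H (suc m) with product-primeDivisorsBelow-step m
  ... | inj₂ eq rewrite eq = product-primeDivisorsBelow-square-∣ H m
  ... | inj₁ ((pm , m∣n) , eq) rewrite eq =
    prime-square-extends-square-∣ pm (prime∤product-primeDivisorsBelow m pm ≤-refl)
      (H m pm m∣n) (product-primeDivisorsBelow-square-∣ H m)

  rad*rad∣ : ∀ {M} → (∀ p → Prime p → p ∣ n → p * p ∣ M) → rad n * rad n ∣ M
  rad*rad∣ H = product-primeDivisorsBelow-square-∣ H (suc n)

coprime-*ˡ : ∀ {m n o} → Coprime m o → Coprime n o → Coprime (m * n) o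
coprime-*ˡ {m} cop-m cop-n (c∣mn , c∣o) = cop-n (coprime-divisor c⊥m c∣mn , c∣o)
  where
  c⊥m : Coprime _ m
  c⊥m (e∣c , e∣m) = cop-m (e∣m , ∣-trans e∣c c∣o)

coprime-*ʳ : ∀ {m n o} → Coprime o m → Coprime o n → Coprime o (m * n)
coprime-*ʳ cop-m cop-n = Cop.sym (coprime-*ˡ (Cop.sym cop-m) (Cop.sym cop-n))

coprime-+-* : ∀ {m n} k → Coprime m n → Coprime (m + k * n) n
coprime-+-* {m} {n} k cop {c} (c∣m+kn , c∣n) =
  cop (∣m+n∣m⇒∣n (subst (c ∣_) (+-comm m (k * n)) c∣m+kn) (∣n⇒∣m*n k c∣n) , c∣n)

m*m≤n<o⇒m^6<o^3 : ∀ {m n o} → m * m ≤ n → n < o → m ^ 6 < o ^ 3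
m*m≤n<o⇒m^6<o^3 {m} {n} {o} m*m≤n n<o = begin-strict
  m ^ 6       ≡⟨ solve 1 (λ m → m :^ 6 := (m :* m) :^ 3) refl m ⟩
  (m * m) ^ 3 ≤⟨ ^-monoˡ-≤ 3 m*m≤n ⟩
  n ^ 3       <⟨ ^-monoˡ-< 3 n<o ⟩
  o ^ 3       ∎
  where open ≤-Reasoning

powerful-rad*rad∣ : ∀ {x y z d} → Powerful x → Powerful y → Powerful z →
  rad (x * z * (d * d) * (y * y)) * rad (x * z * (d * d) * (y * y)) ∣ x * y * z * (d * d)
powerful-rad*rad∣ {x} {y} {z} {d} px py pz = rad*rad∣ _ prime-square-∣
  where
  prime-square-∣ : ∀ p → Prime p → p ∣ x * z * (d * d) * (y * y) → p * p ∣ x * y * z * (d * d)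
  prime-square-∣ p pp p∣n with euclidsLemma (x * z * (d * d)) (y * y) pp p∣n
  ... | inj₂ p∣yy = ∣m⇒∣m*n (d * d) (∣m⇒∣m*n z (∣n⇒∣m*n x
                      (powerful⇒prime*prime∣ py pp (prime∣m*m⇒∣m y pp p∣yy))))
  ... | inj₁ p∣xzdd with euclidsLemma (x * z) (d * d) pp p∣xzdd
  ...   | inj₂ p∣dd = ∣n⇒∣m*n (x * y * z) (*-pres-∣ p∣d p∣d)
    where p∣d = prime∣m*m⇒∣m d pp p∣dd
  ...   | inj₁ p∣xz with euclidsLemma x z pp p∣xz
  ...     | inj₁ p∣x = ∣m⇒∣m*n (d * d) (∣m⇒∣m*n z (∣m⇒∣m*n y (powerful⇒prime*prime∣ px pp p∣x)))
  ...     | inj₂ p∣z = ∣m⇒∣m*n (d * d) (∣n⇒∣m*n (x * y) (powerful⇒prime*prime∣ pz pp p∣z))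

square-sum-abcExceptional : ∀ {x y z d} → Powerful x → Powerful y → Powerful z →
  Coprime x d → Coprime z d → 1 ≤ x → 1 ≤ z → 1 ≤ d →
  x * z + d * d ≡ y * y → d ^ 6 ≤ y → ABCExceptional 1 5 (x * z) (d * d) (y * y)
square-sum-abcExceptional {x} {y} {z} {d} px py pz x⊥d z⊥d 1≤x 1≤z 1≤d xz+dd≡yy d⁶≤y =
  *-mono-≤ 1≤x 1≤z , 1≤dd ,
  coprime⇒gcd≡1 (coprime-*ˡ (coprime-*ʳ x⊥d x⊥d) (coprime-*ʳ z⊥d z⊥d)) ,
  xz+dd≡yy ,
  <-≤-trans (m*m≤n<o⇒m^6<o^3 {rad (x * z * (d * d) * (y * y))} rad*rad≤xyzdd xyzdd<y³d²) y³d²-cubed≤y¹⁰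
  where
  open ≤-Reasoning
  1≤dd : 1 ≤ d * d
  1≤dd = *-mono-≤ 1≤d 1≤d
  1≤y : 1 ≤ y
  1≤y = ≤-trans (m^n>0 d {{>-nonZero 1≤d}} 6) d⁶≤y
  rad*rad≤xyzdd : rad (x * z * (d * d) * (y * y)) * rad (x * z * (d * d) * (y * y)) ≤ x * y * z * (d * d)
  rad*rad≤xyzdd = ∣⇒≤ {{>-nonZero (*-mono-≤ (*-mono-≤ (*-mono-≤ 1≤x 1≤y) 1≤z) 1≤dd)}}
                      (powerful-rad*rad∣ {d = d} px py pz)
  xyzdd<y³d² : x * y * z * (d * d) < y * y * (y * (d * d))
  xyzdd<y³d² = begin-strict
    x * y * z * (d * d)   ≡⟨ solve 4 (λ x y z d → x :* y :* z :* (d :* d) := x :* z :* (y :* (d :* d))) refl x y z d ⟩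
    x * z * (y * (d * d)) <⟨ *-monoˡ-< (y * (d * d)) {{>-nonZero (*-mono-≤ 1≤y 1≤dd)}}
                               (subst (x * z <_) xz+dd≡yy (m<m+n (x * z) 1≤dd)) ⟩
    y * y * (y * (d * d)) ∎
  y³d²-cubed≤y¹⁰ : (y * y * (y * (d * d))) ^ 3 ≤ (y * y) ^ 5
  y³d²-cubed≤y¹⁰ = begin
    (y * y * (y * (d * d))) ^ 3 ≡⟨ solve 2 (λ y d → (y :* y :* (y :* (d :* d))) :^ 3 := y :^ 9 :* d :^ 6) refl y d ⟩
    y ^ 9 * d ^ 6               ≤⟨ *-monoʳ-≤ (y ^ 9) d⁶≤y ⟩
    y ^ 9 * y                   ≡⟨ solve 1 (λ y → y :^ 9 :* y := (y :* y) :^ 5) refl y ⟩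
    (y * y) ^ 5                 ∎

progression-square : ∀ a d k → (a + k * d) * (a + (k + 2) * d) + d * d ≡ (a + (k + 1) * d) * (a + (k + 1) * d)
progression-square = solve 3 (λ a d k →
  (a :+ k :* d) :* (a :+ (k :+ con 2) :* d) :+ d :* d := (a :+ (k :+ con 1) :* d) :* (a :+ (k :+ con 1) :* d)) refl

index<progression-term : ∀ a {d} k → 1 ≤ d → k < a + (k + 1) * d
index<progression-term a {d} k 1≤d = begin-strict
  k             <⟨ m<m+n k z<s ⟩
  k + 1         ≤⟨ m≤m*n (k + 1) d {{>-nonZero 1≤d}} ⟩
  (k + 1) * d   ≤⟨ m≤n+m _ a ⟩
  a + (k + 1) * d ∎
  where open ≤-Reasoning

theorem5p1 : ABC → (a d : ℕ) → 1 ≤ a → 1 ≤ d → gcd a d ≡ 1 →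
    ∃[ N ] (∀ k → Powerful (a + k * d) → Powerful (a + (k + 1) * d) →
      Powerful (a + (k + 2) * d) → k < N)
theorem5p1 abc a d 1≤a 1≤d gcd≡1 with abc 1 5 (s≤s z≤n) (s≤s z≤n)
... | N , bound = N + d ^ 6 , k<N+d⁶
  where
  term : ℕ → ℕ
  term j = a + j * d
  1≤term : ∀ j → 1 ≤ term j
  1≤term j = ≤-trans 1≤a (m≤m+n a (j * d))
  term⊥d : ∀ j → Coprime (term j) d
  term⊥d j = coprime-+-* j (gcd≡1⇒coprime gcd≡1)
  k<N+d⁶ : ∀ k → Powerful (term k) → Powerful (term (k + 1)) → Powerful (term (k + 2)) → k < N + d ^ 6
  k<N+d⁶ k px py pz with d ^ 6 ≤? term (k + 1)
  ... | no d⁶≰y = <-≤-trans (<-trans (index<progression-term a k 1≤d) (≰⇒> d⁶≰y)) (m≤n+m _ N)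
  ... | yes d⁶≤y = <-≤-trans (<-≤-trans (index<progression-term a k 1≤d) y≤y*y) (≤-trans (<⇒≤ y*y<N) (m≤m+n N _))
    where
    y≤y*y : term (k + 1) ≤ term (k + 1) * term (k + 1)
    y≤y*y = m≤m*n (term (k + 1)) (term (k + 1)) {{>-nonZero (1≤term (k + 1))}}
    y*y<N : term (k + 1) * term (k + 1) < N
    y*y<N = bound _ _ _ (square-sum-abcExceptional px py pz (term⊥d k) (term⊥d (k + 2))
                           (1≤term k) (1≤term (k + 2)) 1≤d (progression-square a d k) d⁶≤y)
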